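{- Let $M$ be a countable cycle-free partial order. If for every $n\in\mathbb{N}$ the partial order $\mathrm{Alt}_n$ embeds in $M$, then $M$ is not $\aleph_0$-categorical.
   Context: For $x,y$ in a partial order, $x\wedge y$ is the supremum of the common lower bounds and $x\vee y$ the infimum of the common upper bounds. A partial order is path complete if $x\wedge y$ exists in it whenever $x,y$ have a common lower bound, and $x\vee y$ exists whenever $x,y$ have a common upper bound; the path completion $M^+$ of $M$ is the smallest path complete partial order containing $M$. A connecting set from $a$ to $b$ in $M$ is a tuple $\langle c_1,\ldots,c_n\rangle$ ($n\geq2$) with $c_1=a$, $c_n=b$, $c_2,\ldots,c_{n-1}\in M^+$, such that $c_i,c_j$ are incomparable whenever $j\neq i\pm1$ (and $j\ne i$), and for $1<i<n$ either $c_{i-1}<c_i>c_{i+1}$ or $c_{i-1}>c_i<c_{i+1}$. Given such a connecting set, choose for each $k<n$ a maximal chain $\sigma_k$ of the interval of $M^+$ with endpoints $c_k,c_{k+1}$, such that $\sigma_i\cap\sigma_j\neq\emptyset$ with $i<j$ implies $j=i+1$ and the intersection is $\{c_{i+1}\}$; then $\bigcup_k\sigma_k$ is a path from $a$ to $b$. $M$ is a cycle-free partial order (CFPO) if for all $x,y\in M$ there is at most one path between $x$ and $y$ in $M^+$. $\mathrm{Alt}$ is the partial order on $\{a_i : i\in\mathbb{Z}\}$ whose only strict relations are $a_{i-1}>a_i<a_{i+1}$ for odd $i$ and $a_{i-1}<a_i>a_{i+1}$ for even $i$; $\mathrm{Alt}_n$ is its restriction to $\{a_0,\ldots,a_{n-1}\}$.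 A countable structure is $\aleph_0$-categorical if it is the unique countable model of its first-order theory (equivalently, its automorphism group has finitely many orbits on $n$-tuples for each $n$). -}

module Defs where

open import Level using (0ℓ)
open import Data.Nat using (ℕ; zero; suc; _+_) renaming (_<_ to _<ℕ_; _≤_ to _≤ℕ_)
open import Data.Fin using (Fin; toℕ)
open import Data.Product using (Σ; ∃; _×_; _,_)
open import Data.Sum using (_⊎_)
open import Relation.Nullary using (¬_)
open import Relation.Binary.PropositionalEquality using (_≡_; _≢_)
open import Relation.Binary.Structures using (IsPartialOrder)
open import Function.Definitions using (Injective)

record PO : Set₁ where
  field
    Carrier : Set
    _≤_     : Carrier → Carrier → Set
    isPO    : IsPartialOrder _≡_ _≤_

module _ (P : PO) where
  open PO P

  _<ₚ_ : Carrier → Carrier → Set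
  x <ₚ y = x ≤ y × x ≢ y

  Incomparable : Carrier → Carrier → Set
  Incomparable x y = ¬ (x ≤ y) × ¬ (y ≤ x)

  IsMeet : Carrier → Carrier → Carrier → Set
  IsMeet x y m = (m ≤ x × m ≤ y) × (∀ z → z ≤ x → z ≤ y → z ≤ m)

  IsJoin : Carrier → Carrier → Carrier → Set
  IsJoin x y j = (x ≤ j × y ≤ j) × (∀ z → x ≤ z → y ≤ z → j ≤ z)

  PathComplete : Set
  PathComplete =
    (∀ x y → (∃ λ z → z ≤ x × z ≤ y) → ∃ λ m → IsMeet x y m) ×
    (∀ x y → (∃ λ z → x ≤ z × y ≤ z) → ∃ λ j → IsJoin x y j)

  -- A subset S of P is closed under path-completion operations if whenever
  -- x, y ∈ S have a common lower (upper) bound in S, their meet (join) in P lies in S.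
  -- (Such an S, with the induced order, is itself path complete.)
  PCClosed : (Carrier → Set) → Set
  PCClosed S =
    (∀ x y m → S x → S y → (∃ λ z → S z × z ≤ x × z ≤ y) → IsMeet x y m → S m) ×
    (∀ x y j → S x → S y → (∃ λ z → S z × x ≤ z × y ≤ z) → IsJoin x y j → S j)

record OrderEmbedding (M P : PO) : Set where
  field
    map       : PO.Carrier M → PO.Carrier P
    injective : ∀ x y → map x ≡ map y → x ≡ y
    preserves : ∀ x y → PO._≤_ M x y → PO._≤_ P (map x) (map y)
    reflects  : ∀ x y → PO._≤_ P (map x) (map y) → PO._≤_ M x y

-- (P , ι) is the path completion M⁺ of M: P is path complete, contains M via the
-- order embedding ι, and is the smallest such: every subset of P containing ι(M)
-- and closed under the meets/joins of path completeness is all of P.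
record PathCompletion (M : PO) : Set₁ where
  field
    P        : PO
    ι        : OrderEmbedding M P
    complete : PathComplete P
    smallest : ∀ (S : PO.Carrier P → Set) →
               (∀ x → S (OrderEmbedding.map ι x)) → PCClosed P S → ∀ p → S p

module _ {M : PO} (C : PathCompletion M) where
  open PathCompletion C
  open PO P renaming (Carrier to P⁺; _≤_ to _≤⁺_)
  private
    _<⁺_ = _<ₚ_ P

  InInterval : P⁺ → P⁺ → P⁺ → Set
  InInterval u v p = (u ≤⁺ p × p ≤⁺ v) ⊎ (v ≤⁺ p × p ≤⁺ u)

  IsMaximalChain : P⁺ → P⁺ → (P⁺ → Set) → Set
  IsMaximalChain u v σ =
    (∀ p → σ p → InInterval u v p) ×
    (∀ p q → σ p → σ q → p ≤⁺ q ⊎ q ≤⁺ p) ×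
    (∀ p → InInterval u v p → (∀ q → σ q → p ≤⁺ q ⊎ q ≤⁺ p) → σ p)

  -- A path from a to b: a connecting set ⟨c₀,…,c_k⟩ (k ≥ 1, i.e. n = k+1 ≥ 2 points,
  -- indexed from 0) together with maximal chains σ₀,…,σ_{k-1} as in the definition.
  record PathData (a b : PO.Carrier M) : Set₁ where
    field
      k       : ℕ
      k≥1     : 1 ≤ℕ k
      c       : ℕ → P⁺
      start   : c 0 ≡ OrderEmbedding.map ι a
      end     : c k ≡ OrderEmbedding.map ι b
      adjComp : ∀ i → i <ℕ k → c i ≤⁺ c (suc i) ⊎ c (suc i) ≤⁺ c i
      incomp  : ∀ i j → i ≤ℕ k → j ≤ℕ k → i ≢ j → suc i ≢ j → suc j ≢ i →
                Incomparable P (c i) (c j)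
      alt     : ∀ i → suc i <ℕ k →
                ((c i <⁺ c (suc i)) × (c (suc (suc i)) <⁺ c (suc i))) ⊎
                ((c (suc i) <⁺ c i) × (c (suc i) <⁺ c (suc (suc i))))
      σ       : ℕ → P⁺ → Set
      chains  : ∀ i → i <ℕ k → IsMaximalChain (c i) (c (suc i)) (σ i)
      disjoint : ∀ i j → i <ℕ j → j <ℕ k → ∀ p → σ i p → σ j p →
                 (j ≡ suc i) × (∀ q → σ i q → σ j q → q ≡ c (suc i))

    path : P⁺ → Set
    path p = ∃ λ i → i <ℕ k × σ i p

  -- M is cycle-free: between any x, y there is at most one path in M⁺.
  CycleFree : Set₁
  CycleFree = ∀ x y (π₁ π₂ : PathData x y) →
              ∀ p → (PathData.path π₁ p → PathData.path π₂ p) ×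
                    (PathData.path π₂ p → PathData.path π₁ p)

Odd : ℕ → Set
Odd i = ∃ λ m → i ≡ suc (m + m)

-- Alt_n on {a₀,…,a_{n-1}}: strict relations a_{i±1} > a_i for odd i.
AltLt : ℕ → ℕ → Set
AltLt i j = Odd i × (j ≡ suc i ⊎ suc j ≡ i)

AltLe : ℕ → ℕ → Set
AltLe i j = i ≡ j ⊎ AltLt i j

AltEmbeds : ℕ → PO → Set
AltEmbeds n M = Σ (Fin n → PO.Carrier M) λ f →
  (∀ i j → f i ≡ f j → i ≡ j) ×
  (∀ i j → (AltLe (toℕ i) (toℕ j) → PO._≤_ M (f i) (f j)) ×
           (PO._≤_ M (f i) (f j) → AltLe (toℕ i) (toℕ j)))

Countable : PO → Set
Countable M = Σ (PO.Carrier M → ℕ) λ f → ∀ x y → f x ≡ f y → x ≡ y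

record Automorphism (M : PO) : Set where
  open PO M
  field
    to      : Carrier → Carrier
    from    : Carrier → Carrier
    to-from : ∀ x → to (from x) ≡ x
    from-to : ∀ x → from (to x) ≡ x
    to-mono : ∀ x y → x ≤ y → to x ≤ to y
    to-refl : ∀ x y → to x ≤ to y → x ≤ y

-- Aut(M) has finitely many orbits on n-tuples, for every n.
Aleph0Categorical : PO → Set
Aleph0Categorical M = ∀ n → Σ ℕ λ r → Σ (Fin r → Fin n → PO.Carrier M) λ reps →
  ∀ (t : Fin n → PO.Carrier M) → ∃ λ (i : Fin r) → Σ (Automorphism M) λ g →
    ∀ x → Automorphism.to g (reps i x) ≡ t x

-- Suppose Aut(M) has r orbits on pairs. Embed Alt_{2r+1} as a zigzag z₀ > z₁ < z₂ > … in M; two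
-- of the pairs (z₀, z₂ᵢ), i ≤ r, lie in one orbit, so some automorphism maps (z₀, z₂ᵢ) to (z₀, z₂ⱼ)
-- with i < j and carries z₀ … z₂ᵢ to a zigzag of half-length i from z₀ to z₂ⱼ. A zigzag of
-- half-length h yields a path in M⁺ whose connecting set alternates joins and meets of its
-- points, and whose minimal points are the h meets. Cycle-freeness makes the two paths from z₀
-- to z₂ⱼ equal, hence i = j.
module Submission where

open import Defs
open import Data.Empty using (⊥; ⊥-elim)
open import Data.Fin using (Fin; toℕ; fromℕ<) renaming (zero to fzero; suc to fsuc)
open import Data.Fin.Properties
  using (toℕ<n; toℕ≤pred[n]; toℕ-fromℕ<; toℕ-injective; fromℕ<-injective; injective⇒≤; pigeonhole)
open import Data.Nat using (ℕ; zero; suc; _+_; _<_; _≤_; z≤n; s≤s; _<?_; _≟_)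
open import Data.Nat.Properties
  using ( +-suc; suc-injective; ≤-trans; <-trans; ≤-refl; n≤1+n; n<1+n; n≮n; <⇒≤; m≤n⇒m<n∨m≡n
        ; <-cmp; ≤-antisym; <-irrefl; ≤∧≢⇒<)
open import Data.Product using (Σ; _×_; _,_; proj₁; proj₂; swap)
open import Data.Sum using (_⊎_; inj₁; inj₂; [_,_]′)
open import Data.Vec.Functional using ([]; _∷_)
open import Function using (_∘_)
open import Relation.Binary.Definitions using (tri<; tri≈; tri>)
open import Relation.Binary.PropositionalEquality
  using (_≡_; _≢_; refl; sym; trans; cong; cong₂; subst; subst₂; module ≡-Reasoning)
open import Relation.Binary.Structures using (IsPartialOrder)
open import Relation.Nullary using (¬_; Dec; yes; no)

double : ℕ → ℕ
double zero    = zero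
double (suc n) = suc (suc (double n))

double≡n+n : ∀ n → double n ≡ n + n
double≡n+n zero    = refl
double≡n+n (suc n) = cong suc (trans (cong suc (double≡n+n n)) (sym (+-suc n n)))

double-injective : ∀ m n → double m ≡ double n → m ≡ n
double-injective zero    zero    _ = refl
double-injective (suc m) (suc n) e = cong suc (double-injective m n (suc-injective (suc-injective e)))

double≢suc-double : ∀ m n → double m ≢ suc (double n)
double≢suc-double (suc zero)    zero    ()
double≢suc-double (suc (suc m)) zero    ()
double≢suc-double (suc m)       (suc n) e =
  double≢suc-double m n (suc-injective (suc-injective e))

double-mono-≤ : ∀ {m n} → m ≤ n → double m ≤ double n
double-mono-≤ z≤n     = z≤n
double-mono-≤ (s≤s p) = s≤s (s≤s (double-mono-≤ p))

double-cancel-≤ : ∀ m n → double m ≤ double n → m ≤ n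
double-cancel-≤ zero    _       _               = z≤n
double-cancel-≤ (suc m) (suc n) (s≤s (s≤s p)) = s≤s (double-cancel-≤ m n p)

double-cancel-< : ∀ m n → suc (double m) ≤ double n → m < n
double-cancel-< m (suc n) (s≤s p) = s≤s (cancel m n p)
  where
  cancel : ∀ m n → double m ≤ suc (double n) → m ≤ n
  cancel zero    _       _               = z≤n
  cancel (suc m) (suc n) (s≤s (s≤s p)) = s≤s (cancel m n p)
  cancel (suc m) zero    (s≤s ())

data Parity : ℕ → Set where
  even : ∀ t → Parity (double t)
  odd  : ∀ t → Parity (suc (double t))

parity : ∀ n → Parity n
parity zero    = even 0
parity (suc n) with parity n
... | even t = odd t
... | odd t  = even (suc t)

even-or-odd : ∀ n → (Σ ℕ λ t → n ≡ double t) ⊎ (Σ ℕ λ t → n ≡ suc (double t))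
even-or-odd n with parity n
... | even t = inj₁ (t , refl)
... | odd t  = inj₂ (t , refl)

parity-double : ∀ t → parity (double t) ≡ even t
parity-double zero    = refl
parity-double (suc t) rewrite parity-double t = refl

parity-suc-double : ∀ t → parity (suc (double t)) ≡ odd t
parity-suc-double t rewrite parity-double t = refl

-- pair a b = 2ᵃ (2b + 1)
pair : ℕ → ℕ → ℕ
pair zero    b = suc (double b)
pair (suc a) b = double (pair a b)

pair-injective : ∀ a b c d → pair a b ≡ pair c d → a ≡ c × b ≡ d
pair-injective zero    b zero    d e = refl , double-injective b d (suc-injective e)
pair-injective zero    b (suc c) d e = ⊥-elim (double≢suc-double (pair c d) b (sym e))
pair-injective (suc a) b zero    d e = ⊥-elim (double≢suc-double (pair a b) d e)
pair-injective (suc a) b (suc c) d e with pair-injective a b c d (double-injective _ _ e)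
... | refl , refl = refl , refl

altLe-odd-prev : ∀ t → AltLe (suc (double t)) (double t)
altLe-odd-prev t = inj₂ ((t , cong suc (double≡n+n t)) , inj₂ refl)

altLe-odd-next : ∀ t → AltLe (suc (double t)) (double (suc t))
altLe-odd-next t = inj₂ ((t , cong suc (double≡n+n t)) , inj₁ refl)

altLe-far : ∀ {ℓ u} → suc (suc ℓ) ≤ u → ¬ AltLe ℓ u × ¬ AltLe u ℓ
altLe-far {ℓ} {u} p = up , down
  where
  up : ¬ AltLe ℓ u
  up (inj₁ refl)            = n≮n _ (≤-trans (n≤1+n _) p)
  up (inj₂ (_ , inj₁ refl)) = n≮n _ p
  up (inj₂ (_ , inj₂ refl)) = n≮n _ (≤-trans (n≤1+n _) (≤-trans (n≤1+n _) p))
  down : ¬ AltLe u ℓ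
  down (inj₁ refl)            = n≮n _ (≤-trans (n≤1+n _) p)
  down (inj₂ (_ , inj₁ refl)) = n≮n _ (≤-trans (n≤1+n _) (≤-trans (n≤1+n _) p))
  down (inj₂ (_ , inj₂ refl)) = n≮n _ p

IsZigzag : (P : PO) → ℕ → (ℕ → PO.Carrier P) → Set
IsZigzag P h z = ∀ a b → a ≤ double h → b ≤ double h →
  (AltLe a b → PO._≤_ P (z a) (z b)) × (PO._≤_ P (z a) (z b) → AltLe a b)

module PathCompletionCountable {M : PO} (C : PathCompletion M)
  (code : PO.Carrier M → ℕ) (code-injective : ∀ x y → code x ≡ code y → x ≡ y) where
  open PathCompletion C
  open PO P renaming (Carrier to P⁺)
  open IsPartialOrder isPO using (antisym)

  data Term : Set where
    leaf       : PO.Carrier M → Term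
    meet join  : Term → Term → Term

  Denotes : Term → P⁺ → Set
  Denotes (leaf x)   p = OrderEmbedding.map ι x ≡ p
  Denotes (meet t u) p = Σ P⁺ λ a → Σ P⁺ λ b → Denotes t a × Denotes u b × IsMeet P a b p
  Denotes (join t u) p = Σ P⁺ λ a → Σ P⁺ λ b → Denotes t a × Denotes u b × IsJoin P a b p

  denotes-functional : ∀ t {p q} → Denotes t p → Denotes t q → p ≡ q
  denotes-functional (leaf x) refl refl = refl
  denotes-functional (meet t u) (a , b , ta , ub , (p≤a , p≤b) , p-max)
                                (a' , b' , ta' , ub' , (q≤a , q≤b) , q-max)
    with denotes-functional t ta ta' | denotes-functional u ub ub'
  ... | refl | refl = antisym (q-max _ p≤a p≤b) (p-max _ q≤a q≤b)
  denotes-functional (join t u) (a , b , ta , ub , (a≤p , b≤p) , p-min)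
                                (a' , b' , ta' , ub' , (a≤q , b≤q) , q-min)
    with denotes-functional t ta ta' | denotes-functional u ub ub'
  ... | refl | refl = antisym (p-min _ a≤q b≤q) (q-min _ a≤p b≤p)

  -- The denotable points contain ι(M) and are closed under the meets and joins of P, so
  -- minimality of the path completion makes every point denotable.
  denotation : ∀ p → Σ Term λ t → Denotes t p
  denotation = smallest (λ p → Σ Term λ t → Denotes t p) (λ x → leaf x , refl)
    ( (λ x y _ (t , tx) (u , uy) _ m → meet t u , x , y , tx , uy , m)
    , (λ x y _ (t , tx) (u , uy) _ j → join t u , x , y , tx , uy , j))

  tag : Term → ℕ
  tag (leaf _)   = 0
  tag (meet _ _) = 1
  tag (join _ _) = 2

  encode payload : Term → ℕ
  encode t = pair (tag t) (payload t)
  payload (leaf x)   = code x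
  payload (meet t u) = pair (encode t) (encode u)
  payload (join t u) = pair (encode t) (encode u)

  encode-injective : ∀ t u → encode t ≡ encode u → t ≡ u
  encode-injective t u e with pair-injective (tag t) (payload t) (tag u) (payload u) e
  encode-injective (leaf x)    (leaf y)    _ | _ , e = cong leaf (code-injective x y e)
  encode-injective (meet t t') (meet u u') _ | _ , e =
    let et , et' = pair-injective (encode t) (encode t') (encode u) (encode u') e in
    cong₂ meet (encode-injective t u et) (encode-injective t' u' et')
  encode-injective (join t t') (join u u') _ | _ , e =
    let et , et' = pair-injective (encode t) (encode t') (encode u) (encode u') e in
    cong₂ join (encode-injective t u et) (encode-injective t' u' et')
  encode-injective (leaf _)   (meet _ _) _ | () , _
  encode-injective (leaf _)   (join _ _) _ | () , _
  encode-injective (meet _ _) (leaf _)   _ | () , _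
  encode-injective (meet _ _) (join _ _) _ | () , _
  encode-injective (join _ _) (leaf _)   _ | () , _
  encode-injective (join _ _) (meet _ _) _ | () , _

  code⁺ : P⁺ → ℕ
  code⁺ p = encode (proj₁ (denotation p))

  code⁺-injective : ∀ p q → code⁺ p ≡ code⁺ q → p ≡ q
  code⁺-injective p q e with denotation p | denotation q
  ... | t , tp | u , uq with encode-injective t u e
  ...   | refl = denotes-functional t tp uq

module GreedyChain (P : PO) (code : PO.Carrier P → ℕ)
  (code-injective : ∀ p q → code p ≡ code q → p ≡ q) (I : PO.Carrier P → Set) where
  open PO P renaming (_≤_ to _⊑_)
  open IsPartialOrder isPO using (reflexive)

  Comparable : Carrier → Carrier → Set
  Comparable p q = p ⊑ q ⊎ q ⊑ p

  -- The greedy chain along the enumeration by code: p ∈ I is kept when it is comparable with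
  -- every earlier kept point. The stage n only bounds the recursion; past code p it is
  -- irrelevant (kept-stable), which is what makes the greedy choice definable without
  -- deciding comparability.
  Kept : ℕ → Carrier → Set
  Kept zero    p = ⊥
  Kept (suc n) p = I p × (∀ q → code q < code p → Kept n q → Comparable p q)

  kept-stable : ∀ n m p → code p < n → code p < m → Kept n p → Kept m p
  kept-stable (suc n) (suc m) p (s≤s a) (s≤s b) (Ip , comparable) =
    Ip , λ q q<p kept → comparable q q<p (kept-stable m n q (≤-trans q<p b) (≤-trans q<p a) kept)

  chain : Carrier → Set
  chain p = Kept (suc (code p)) p

  chain⊆I : ∀ p → chain p → I p
  chain⊆I p = proj₁

  chain-maximal : ∀ p → I p → (∀ q → chain q → Comparable p q) → chain p
  chain-maximal p Ip comparable =
    Ip , λ q q<p kept → comparable q (kept-stable (code p) (suc (code q)) q q<p ≤-refl kept)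

  chain-comparable : ∀ p q → chain p → chain q → Comparable p q
  chain-comparable p q cp cq with <-cmp (code p) (code q)
  ... | tri< p<q _ _ with proj₂ cq p p<q (kept-stable (suc (code p)) (code q) p ≤-refl p<q cp)
  ...   | inj₁ q≤p = inj₂ q≤p
  ...   | inj₂ p≤q = inj₁ p≤q
  chain-comparable p q cp cq | tri≈ _ e _ = inj₁ (reflexive (code-injective p q e))
  chain-comparable p q cp cq | tri> _ _ q<p =
    proj₂ cp q q<p (kept-stable (suc (code q)) (code p) q ≤-refl q<p cq)

extend : {A : Set} {B : ℕ → Set} → (∀ t → Dec (B t)) → (∀ t → B t → A) → (ℕ → A) → ℕ → A
extend B? g d t with B? t
... | yes b = g t b
... | no _  = d t

extend-elim : {A : Set} {B : ℕ → Set} (B? : ∀ t → Dec (B t)) {g : ∀ t → B t → A} {d : ℕ → A}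
  (Q : ℕ → A → Set) → (∀ t b → Q t (g t b)) → (∀ t → ¬ B t → Q t (d t)) →
  ∀ t → Q t (extend B? g d t)
extend-elim B? Q on-yes on-no t with B? t
... | yes b = on-yes t b
... | no ¬b = on-no t ¬b

extend-yes : {A : Set} {B : ℕ → Set} (B? : ∀ t → Dec (B t)) {g : ∀ t → B t → A} {d : ℕ → A}
  (Q : ℕ → A → Set) → (∀ t b → Q t (g t b)) → ∀ {t} → B t → Q t (extend B? g d t)
extend-yes {B = B} B? Q on-yes {t} =
  extend-elim B? (λ t a → B t → Q t a) (λ t b _ → on-yes t b) (λ _ ¬b b → ⊥-elim (¬b b)) t

extend-no : {A : Set} {B : ℕ → Set} (B? : ∀ t → Dec (B t)) {g : ∀ t → B t → A} {d : ℕ → A} →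
  ∀ {t} → ¬ B t → extend B? g d t ≡ d t
extend-no B? {t = t} =
  extend-elim B? (λ t a → ¬ _ → a ≡ _) (λ _ b ¬b → ⊥-elim (¬b b)) (λ _ _ _ → refl) t

module Intervals {M : PO} (C : PathCompletion M) where
  open PathCompletion C
  open PO P renaming (Carrier to P⁺; _≤_ to _⊑_)
  open IsPartialOrder isPO using () renaming (refl to ⊑-refl; trans to ⊑-trans)

  interval-descending : ∀ {u v p} → v ⊑ u → InInterval C u v p → v ⊑ p × p ⊑ u
  interval-descending v⊑u (inj₁ (u⊑p , p⊑v)) = ⊑-trans v⊑u u⊑p , ⊑-trans p⊑v v⊑u
  interval-descending v⊑u (inj₂ v⊑p⊑u)      = v⊑p⊑u

  interval-ascending : ∀ {u v p} → u ⊑ v → InInterval C u v p → u ⊑ p × p ⊑ v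
  interval-ascending u⊑v (inj₁ u⊑p⊑v)      = u⊑p⊑v
  interval-ascending u⊑v (inj₂ (v⊑p , p⊑u)) = ⊑-trans u⊑v v⊑p , ⊑-trans p⊑u u⊑v

  maximalChain-∋-lowerʳ : ∀ {u v σ} → v ⊑ u → IsMaximalChain C u v σ → σ v
  maximalChain-∋-lowerʳ v⊑u (σ⊆I , _ , maximal) = maximal _ (inj₂ (⊑-refl , v⊑u))
    (λ q σq → inj₁ (proj₁ (interval-descending v⊑u (σ⊆I q σq))))

  maximalChain-∋-lowerˡ : ∀ {u v σ} → u ⊑ v → IsMaximalChain C u v σ → σ u
  maximalChain-∋-lowerˡ u⊑v (σ⊆I , _ , maximal) = maximal _ (inj₁ (⊑-refl , u⊑v))
    (λ q σq → inj₁ (proj₁ (interval-ascending u⊑v (σ⊆I q σq))))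

  interval-lower-end : ∀ {u v p} → InInterval C u v p → u ⊑ p ⊎ v ⊑ p
  interval-lower-end (inj₁ (u⊑p , _)) = inj₁ u⊑p
  interval-lower-end (inj₂ (v⊑p , _)) = inj₂ v⊑p

  interval-upper-end : ∀ {u v p} → InInterval C u v p → p ⊑ u ⊎ p ⊑ v
  interval-upper-end (inj₁ (_ , p⊑v)) = inj₂ p⊑v
  interval-upper-end (inj₂ (_ , p⊑u)) = inj₁ p⊑u

module PathValleys {M : PO} (C : PathCompletion M) where
  open PathCompletion C
  open PO P renaming (Carrier to P⁺; _≤_ to _⊑_)
  open IsPartialOrder isPO renaming (trans to ⊑-trans)
  open Intervals C

  OddPointsAreValleys : ∀ {x y} → PathData C x y → ℕ → Set
  OddPointsAreValleys π h = k ≡ double h ×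
    (∀ t → t < h → c (suc (double t)) ⊑ c (double t) × c (suc (double t)) ⊑ c (double (suc t)))
    where open PathData π

  module Valleys {x y} (π : PathData C x y) (h : ℕ) (shape : OddPointsAreValleys π h) where
    open PathData π

    private
      odd⊑prev : ∀ {t} → t < h → c (suc (double t)) ⊑ c (double t)
      odd⊑prev t<h = proj₁ (proj₂ shape _ t<h)

      odd⊑next : ∀ {t} → t < h → c (suc (double t)) ⊑ c (double (suc t))
      odd⊑next t<h = proj₂ (proj₂ shape _ t<h)

      <k⇒<2h : ∀ {i} → i < k → i < double h
      <k⇒<2h = subst (_ <_) (proj₁ shape)

      <2h⇒<k : ∀ {i} → i < double h → i < k
      <2h⇒<k = subst (_ <_) (sym (proj₁ shape))

      odd<2h : ∀ {t} → t < h → suc (double t) < double h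
      odd<2h t<h = double-mono-≤ t<h

      odd≤k : ∀ {t} → t < h → suc (double t) ≤ k
      odd≤k t<h = subst (_ ≤_) (sym (proj₁ shape)) (<⇒≤ (odd<2h t<h))

      even<2h : ∀ {t} → t < h → double t < double h
      even<2h t<h = <-trans (n<1+n _) (odd<2h t<h)

    Minimal : P⁺ → Set
    Minimal p = path p × (∀ q → path q → q ⊑ p → q ≡ p)

    valley-on-path : ∀ {t} → t < h → σ (double t) (c (suc (double t)))
    valley-on-path t<h = maximalChain-∋-lowerʳ (odd⊑prev t<h) (chains _ (<2h⇒<k (even<2h t<h)))

    valley-below-path : ∀ {l p} → l < k → σ l p →
      Σ ℕ λ t → t < h × c (suc (double t)) ⊑ p × σ l (c (suc (double t)))
    valley-below-path {l} {p} l<k σlp with even-or-odd l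
    ... | inj₁ (t , refl) = let t<h = double-cancel-< t h (<k⇒<2h l<k) in
      t , t<h , proj₁ (interval-descending (odd⊑prev t<h) (proj₁ (chains _ l<k) p σlp)) , valley-on-path t<h
    ... | inj₂ (t , refl) = let t<h = double-cancel-≤ (suc t) h (<k⇒<2h l<k) in
      t , t<h , proj₁ (interval-ascending (odd⊑next t<h) (proj₁ (chains _ l<k) p σlp)) ,
      maximalChain-∋-lowerˡ (odd⊑next t<h) (chains _ l<k)

    valley-⊑-injective : ∀ {t t'} → t < h → t' < h → c (suc (double t')) ⊑ c (suc (double t)) → t' ≡ t
    valley-⊑-injective {t} {t'} t<h t'<h t'⊑t with t' ≟ t
    ... | yes t'≡t = t'≡t
    ... | no t'≢t = ⊥-elim (proj₁ (incomp _ _ (odd≤k t'<h) (odd≤k t<h)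
      (λ e → t'≢t (double-injective t' t (suc-injective e)))
      (double≢suc-double (suc t') t) (double≢suc-double (suc t) t')) t'⊑t)

    valley-minimal : ∀ {t} → t < h → Minimal (c (suc (double t)))
    valley-minimal {t} t<h = (double t , <2h⇒<k (even<2h t<h) , valley-on-path t<h) , least
      where
      least : ∀ q → path q → q ⊑ c (suc (double t)) → q ≡ c (suc (double t))
      least q (l , l<k , σlq) q⊑t with valley-below-path l<k σlq
      ... | t' , t'<h , t'⊑q , _ with valley-⊑-injective t<h t'<h (⊑-trans t'⊑q q⊑t)
      ...   | refl = antisym q⊑t t'⊑q

    minimal⇒valley : ∀ {p} → Minimal p → Σ ℕ λ t → t < h × p ≡ c (suc (double t))
    minimal⇒valley {p} ((l , l<k , σlp) , least) with valley-below-path l<k σlp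
    ... | t , t<h , t⊑p , σlt = t , t<h , sym (least _ (l , l<k , σlt) t⊑p)

  -- Valleys are the minimal points of a path, so equal paths have equally many valleys.
  valley-count-≤ : ∀ {x y} (π₁ π₂ : PathData C x y) {h₁ h₂} →
    OddPointsAreValleys π₁ h₁ → OddPointsAreValleys π₂ h₂ →
    (∀ p → (PathData.path π₁ p → PathData.path π₂ p) × (PathData.path π₂ p → PathData.path π₁ p)) →
    h₁ ≤ h₂
  valley-count-≤ π₁ π₂ {h₁} {h₂} shape₁ shape₂ samePath = injective⇒≤ {f = φ} φ-injective
    where
    module V₁ = Valleys π₁ h₁ shape₁
    module V₂ = Valleys π₂ h₂ shape₂
    c₁ c₂ : ℕ → P⁺
    c₁ = PathData.c π₁
    c₂ = PathData.c π₂

    minimal₁⇒minimal₂ : ∀ {p} → V₁.Minimal p → V₂.Minimal p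
    minimal₁⇒minimal₂ {p} (on₁ , least₁) =
      proj₁ (samePath p) on₁ , λ q on₂ q⊑p → least₁ q (proj₂ (samePath q) on₂) q⊑p

    match : (a : Fin h₁) → Σ ℕ λ t → t < h₂ × c₁ (suc (double (toℕ a))) ≡ c₂ (suc (double t))
    match a = V₂.minimal⇒valley (minimal₁⇒minimal₂ (V₁.valley-minimal (toℕ<n a)))

    φ : Fin h₁ → Fin h₂
    φ a = fromℕ< (proj₁ (proj₂ (match a)))

    φ-injective : ∀ {a b} → φ a ≡ φ b → a ≡ b
    φ-injective {a} {b} φa≡φb =
      toℕ-injective (sym (V₁.valley-⊑-injective (toℕ<n a) (toℕ<n b) (reflexive valley-b≡valley-a)))
      where
      open ≡-Reasoning
      valley-b≡valley-a : c₁ (suc (double (toℕ b))) ≡ c₁ (suc (double (toℕ a)))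
      valley-b≡valley-a = begin
        c₁ (suc (double (toℕ b)))           ≡⟨ proj₂ (proj₂ (match b)) ⟩
        c₂ (suc (double (proj₁ (match b))))
          ≡⟨ cong (λ t → c₂ (suc (double t))) (fromℕ<-injective _ _ _ _ φa≡φb) ⟨
        c₂ (suc (double (proj₁ (match a)))) ≡⟨ proj₂ (proj₂ (match a)) ⟨
        c₁ (suc (double (toℕ a)))           ∎

-- The connecting set alternates the meets of consecutive upper points of the zigzag (the
-- valleys) with the joins of consecutive valleys (the peaks); these are what make the
-- maximal chains of adjacent intervals meet only in their common endpoint.
module ZigzagPath {M : PO} (C : PathCompletion M)
  (code : PO.Carrier (PathCompletion.P C) → ℕ)
  (code-injective : ∀ p q → code p ≡ code q → p ≡ q)
  (h : ℕ) (f : ℕ → PO.Carrier (PathCompletion.P C)) (zigzag : IsZigzag (PathCompletion.P C) h f)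
  where
  open PathCompletion C
  open PO P renaming (Carrier to P⁺; _≤_ to _⊑_)
  open IsPartialOrder isPO renaming (refl to ⊑-refl; trans to ⊑-trans)
  open Intervals C

  private
    odd≤ : ∀ {t} → t < h → suc (double t) ≤ double h
    odd≤ t<h = ≤-trans (n≤1+n _) (double-mono-≤ t<h)

    even≤ : ∀ {t} → t < h → double t ≤ double h
    even≤ t<h = ≤-trans (n≤1+n _) (odd≤ t<h)

    next≤ : ∀ {t} → t < h → double (suc t) ≤ double h
    next≤ = double-mono-≤

    pred< : ∀ {t} → suc t < h → t < h
    pred< = ≤-trans (n≤1+n _)

  f-odd⊑f-prev : ∀ {t} → t < h → f (suc (double t)) ⊑ f (double t)
  f-odd⊑f-prev t<h = proj₁ (zigzag _ _ (odd≤ t<h) (even≤ t<h)) (altLe-odd-prev _)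

  f-odd⊑f-next : ∀ {t} → t < h → f (suc (double t)) ⊑ f (double (suc t))
  f-odd⊑f-next t<h = proj₁ (zigzag _ _ (odd≤ t<h) (next≤ t<h)) (altLe-odd-next _)

  valley-exists : ∀ t → t < h → Σ P⁺ (IsMeet P (f (double t)) (f (double (suc t))))
  valley-exists t t<h = proj₁ complete _ _ (f (suc (double t)) , f-odd⊑f-prev t<h , f-odd⊑f-next t<h)

  valley : ℕ → P⁺
  valley = extend (_<? h) (λ t t<h → proj₁ (valley-exists t t<h)) (λ _ → f 0)

  valley-isMeet : ∀ {t} → t < h → IsMeet P (f (double t)) (f (double (suc t))) (valley t)
  valley-isMeet = extend-yes (_<? h) (λ t → IsMeet P (f (double t)) (f (double (suc t))))
    (λ t t<h → proj₂ (valley-exists t t<h))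

  valley⊑f-prev : ∀ {t} → t < h → valley t ⊑ f (double t)
  valley⊑f-prev t<h = proj₁ (proj₁ (valley-isMeet t<h))

  valley⊑f-next : ∀ {t} → t < h → valley t ⊑ f (double (suc t))
  valley⊑f-next t<h = proj₂ (proj₁ (valley-isMeet t<h))

  f-odd⊑valley : ∀ {t} → t < h → f (suc (double t)) ⊑ valley t
  f-odd⊑valley t<h = proj₂ (valley-isMeet t<h) _ (f-odd⊑f-prev t<h) (f-odd⊑f-next t<h)

  peak-exists : ∀ t → suc t < h → Σ P⁺ (IsJoin P (valley t) (valley (suc t)))
  peak-exists t t+1<h =
    proj₂ complete _ _ (f (double (suc t)) , valley⊑f-next (pred< t+1<h) , valley⊑f-prev t+1<h)

  peak : ℕ → P⁺
  peak zero    = f 0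
  peak (suc t) = extend (λ t → suc t <? h) (λ t t+1<h → proj₁ (peak-exists t t+1<h))
                        (λ t → f (double (suc t))) t

  peak-isJoin : ∀ {t} → suc t < h → IsJoin P (valley t) (valley (suc t)) (peak (suc t))
  peak-isJoin = extend-yes (λ t → suc t <? h) (λ t → IsJoin P (valley t) (valley (suc t)))
    (λ t t+1<h → proj₂ (peak-exists t t+1<h))

  peak-last : peak h ≡ f (double h)
  peak-last = at h refl
    where
    at : ∀ n → n ≡ h → peak n ≡ f (double n)
    at zero    _   = refl
    at (suc m) m+1≡h = extend-no (λ t → suc t <? h) (λ m+1<h → n≮n h (subst (_< h) m+1≡h m+1<h))

  peak⊑f : ∀ t → peak t ⊑ f (double t)
  peak⊑f zero    = ⊑-refl
  peak⊑f (suc t) = extend-elim (λ t → suc t <? h) (λ t p → p ⊑ f (double (suc t)))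
    (λ t t+1<h → proj₂ (proj₂ (peak-exists t t+1<h)) _ (valley⊑f-next (pred< t+1<h)) (valley⊑f-prev t+1<h))
    (λ _ _ → ⊑-refl) t

  valley⊑peak : ∀ {t} → t < h → valley t ⊑ peak t
  valley⊑peak {zero}  0<h   = valley⊑f-prev 0<h
  valley⊑peak {suc t} t+1<h = proj₂ (proj₁ (peak-isJoin t+1<h))

  valley⊑next-peak : ∀ {t} → t < h → valley t ⊑ peak (suc t)
  valley⊑next-peak {t} = extend-elim (λ t → suc t <? h) (λ t p → t < h → valley t ⊑ p)
    (λ t t+1<h _ → proj₁ (proj₁ (proj₂ (peak-exists t t+1<h)))) (λ _ _ t<h → valley⊑f-next t<h) t

  pointAt : ∀ {n} → Parity n → P⁺
  pointAt (even t) = peak t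
  pointAt (odd t)  = valley t

  point : ℕ → P⁺
  point n = pointAt (parity n)

  point-even : ∀ t → point (double t) ≡ peak t
  point-even t = cong pointAt (parity-double t)

  point-odd : ∀ t → point (suc (double t)) ≡ valley t
  point-odd t = cong pointAt (parity-suc-double t)

  point-even⊑f : ∀ t → point (double t) ⊑ f (double t)
  point-even⊑f t = ≲-respˡ-≈ (sym (point-even t)) (peak⊑f t)

  point-odd⊑point-prev : ∀ {t} → t < h → point (suc (double t)) ⊑ point (double t)
  point-odd⊑point-prev {t} t<h =
    ≲-respˡ-≈ (sym (point-odd t)) (≲-respʳ-≈ (sym (point-even t)) (valley⊑peak t<h))

  point-odd⊑point-next : ∀ {t} → t < h → point (suc (double t)) ⊑ point (double (suc t))
  point-odd⊑point-next {t} t<h =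
    ≲-respˡ-≈ (sym (point-odd t)) (≲-respʳ-≈ (sym (point-even (suc t))) (valley⊑next-peak t<h))

  f-left⊑point : ∀ s → s ≤ double h → Σ ℕ λ ℓ → ℓ ≤ s × f ℓ ⊑ point s
  f-left⊑point s s≤2h with parity s
  ... | even zero    = 0 , z≤n , ⊑-refl
  ... | even (suc t) = let t<h = double-cancel-≤ (suc t) h s≤2h in
    suc (double t) , n≤1+n _ , ⊑-trans (f-odd⊑valley t<h) (valley⊑next-peak t<h)
  ... | odd t        = suc (double t) , ≤-refl , f-odd⊑valley (double-cancel-< t h s≤2h)

  f-right⊑point : ∀ s → s ≤ double h → Σ ℕ λ ℓ → s ≤ ℓ × ℓ ≤ double h × f ℓ ⊑ point s
  f-right⊑point s s≤2h with parity s
  ... | odd t  = suc (double t) , ≤-refl , s≤2h , f-odd⊑valley (double-cancel-< t h s≤2h)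
  ... | even t with m≤n⇒m<n∨m≡n (double-cancel-≤ t h s≤2h)
  ...   | inj₁ t<h  = suc (double t) , n≤1+n _ , odd≤ t<h , ⊑-trans (f-odd⊑valley t<h) (valley⊑peak t<h)
  ...   | inj₂ refl = double h , ≤-refl , ≤-refl , ≲-respʳ-≈ (sym peak-last) ⊑-refl

  point⊑f-left : ∀ s → s ≤ double h → Σ ℕ λ u → u ≤ s × point s ⊑ f u
  point⊑f-left s s≤2h with parity s
  ... | even t = double t , ≤-refl , peak⊑f t
  ... | odd t  = double t , n≤1+n _ , valley⊑f-prev (double-cancel-< t h s≤2h)

  point⊑f-right : ∀ s → s ≤ double h → Σ ℕ λ u → s ≤ u × u ≤ double h × point s ⊑ f u
  point⊑f-right s s≤2h with parity s
  ... | even t = double t , ≤-refl , s≤2h , peak⊑f t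
  ... | odd t  = let t<h = double-cancel-< t h s≤2h in
    double (suc t) , n≤1+n _ , next≤ t<h , valley⊑f-next t<h

  -- Each point is squeezed between points of the zigzag at most one step away, and
  -- the zigzag's points at distance ≥ 2 are incomparable.
  point-far-incomparable : ∀ {a b} → a ≤ double h → b ≤ double h → suc (suc a) ≤ b →
                           Incomparable P (point a) (point b)
  point-far-incomparable {a} {b} a≤2h b≤2h a+2≤b = a⋢b , b⋢a
    where
    a⋢b : ¬ point a ⊑ point b
    a⋢b a⊑b with f-left⊑point a a≤2h | point⊑f-right b b≤2h
    ... | ℓ , ℓ≤a , fℓ⊑a | u , b≤u , u≤2h , b⊑fu =
      proj₁ (altLe-far (≤-trans (s≤s (s≤s ℓ≤a)) (≤-trans a+2≤b b≤u)))
        (proj₂ (zigzag ℓ u (≤-trans ℓ≤a a≤2h) u≤2h) (⊑-trans fℓ⊑a (⊑-trans a⊑b b⊑fu)))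
    b⋢a : ¬ point b ⊑ point a
    b⋢a b⊑a with f-right⊑point b b≤2h | point⊑f-left a a≤2h
    ... | ℓ , b≤ℓ , ℓ≤2h , fℓ⊑b | u , u≤a , a⊑fu =
      proj₂ (altLe-far (≤-trans (s≤s (s≤s u≤a)) (≤-trans a+2≤b b≤ℓ)))
        (proj₂ (zigzag ℓ u ℓ≤2h (≤-trans u≤a a≤2h)) (⊑-trans fℓ⊑b (⊑-trans b⊑a a⊑fu)))

  point-adjacent-comparable : ∀ i → i < double h → point i ⊑ point (suc i) ⊎ point (suc i) ⊑ point i
  point-adjacent-comparable i i<2h with even-or-odd i
  ... | inj₁ (t , refl) = inj₂ (point-odd⊑point-prev (double-cancel-< t h i<2h))
  ... | inj₂ (t , refl) = inj₁ (point-odd⊑point-next (double-cancel-≤ (suc t) h i<2h))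

  point-nonadjacent-incomparable : ∀ i j → i ≤ double h → j ≤ double h →
    i ≢ j → suc i ≢ j → suc j ≢ i → Incomparable P (point i) (point j)
  point-nonadjacent-incomparable i j i≤2h j≤2h i≢j i+1≢j j+1≢i with <-cmp i j
  ... | tri< i<j _ _ = point-far-incomparable i≤2h j≤2h (≤∧≢⇒< i<j i+1≢j)
  ... | tri≈ _ i≡j _ = ⊥-elim (i≢j i≡j)
  ... | tri> _ _ j<i = swap (point-far-incomparable j≤2h i≤2h (≤∧≢⇒< j<i j+1≢i))

  private
    ≢-by : ∀ {x y z} → x ⊑ z → ¬ y ⊑ z → x ≢ y
    ≢-by x⊑z y⋢z refl = y⋢z x⊑z

    peaks-incomparable : ∀ {t} → t < h → Incomparable P (point (double t)) (point (double (suc t)))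
    peaks-incomparable t<h = point-far-incomparable (even≤ t<h) (next≤ t<h) ≤-refl

  point-alternates : ∀ i → suc i < double h →
    (_<ₚ_ P (point i) (point (suc i)) × _<ₚ_ P (point (suc (suc i))) (point (suc i))) ⊎
    (_<ₚ_ P (point (suc i)) (point i) × _<ₚ_ P (point (suc i)) (point (suc (suc i))))
  point-alternates i i+1<2h with even-or-odd i
  ... | inj₁ (t , refl) = let t<h = double-cancel-≤ (suc t) h i+1<2h in
    inj₂ ( (point-odd⊑point-prev t<h , ≢-by (point-odd⊑point-next t<h) (proj₁ (peaks-incomparable t<h)))
         , (point-odd⊑point-next t<h , ≢-by (point-odd⊑point-prev t<h) (proj₂ (peaks-incomparable t<h))))
  ... | inj₂ (t , refl) = let t+1<h = double-cancel-< (suc t) h i+1<2h ; t<h = pred< t+1<h in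
    inj₁ ( (point-odd⊑point-next t<h , ≢-by (point-odd⊑point-prev t<h) (proj₂ (peaks-incomparable t<h)))
         , (point-odd⊑point-prev t+1<h , ≢-by (point-odd⊑point-next t+1<h) (proj₁ (peaks-incomparable t+1<h))))

  chain : ℕ → P⁺ → Set
  chain i = GreedyChain.chain P code code-injective (InInterval C (point i) (point (suc i)))

  chain-isMaximal : ∀ i → IsMaximalChain C (point i) (point (suc i)) (chain i)
  chain-isMaximal i = chain⊆I , chain-comparable , chain-maximal
    where open GreedyChain P code code-injective (InInterval C (point i) (point (suc i)))

  chain⊆interval : ∀ i {p} → chain i p → InInterval C (point i) (point (suc i)) p
  chain⊆interval i {p} = proj₁ (chain-isMaximal i) p

  chain-even-bounds : ∀ {t q} → t < h → chain (double t) q →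
                      point (suc (double t)) ⊑ q × q ⊑ point (double t)
  chain-even-bounds {t} t<h = interval-descending (point-odd⊑point-prev t<h) ∘ chain⊆interval (double t)

  chain-odd-bounds : ∀ {t q} → t < h → chain (suc (double t)) q →
                     point (suc (double t)) ⊑ q × q ⊑ point (double (suc t))
  chain-odd-bounds {t} t<h = interval-ascending (point-odd⊑point-next t<h) ∘ chain⊆interval (suc (double t))

  -- A common point of two consecutive chains lies between both neighbours of the shared
  -- endpoint, hence is that endpoint by the meet/join property of valleys/peaks.
  chains-adjacent : ∀ i → suc i < double h → ∀ q → chain i q → chain (suc i) q → q ≡ point (suc i)
  chains-adjacent i i+1<2h q qi qi+1 with even-or-odd i
  ... | inj₁ (t , refl) = antisym (≲-respʳ-≈ (sym (point-odd t)) q⊑valley) (proj₁ (chain-even-bounds t<h qi))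
    where
    t<h : t < h
    t<h = double-cancel-≤ (suc t) h i+1<2h
    q⊑valley : q ⊑ valley t
    q⊑valley = proj₂ (valley-isMeet t<h) q
      (⊑-trans (proj₂ (chain-even-bounds t<h qi)) (point-even⊑f t))
      (⊑-trans (proj₂ (chain-odd-bounds t<h qi+1)) (point-even⊑f (suc t)))
  ... | inj₂ (t , refl) =
    antisym (proj₂ (chain-even-bounds t+1<h qi+1)) (≲-respˡ-≈ (sym (point-even (suc t))) peak⊑q)
    where
    t+1<h : suc t < h
    t+1<h = double-cancel-< (suc t) h i+1<2h
    peak⊑q : peak (suc t) ⊑ q
    peak⊑q = proj₂ (peak-isJoin t+1<h) q
      (≲-respˡ-≈ (point-odd t) (proj₁ (chain-odd-bounds (pred< t+1<h) qi)))
      (≲-respˡ-≈ (point-odd (suc t)) (proj₁ (chain-even-bounds t+1<h qi+1)))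

  private
    nonadjacent-<-bound : ∀ {i j} → suc (suc i) ≤ j → j < double h → i < double h
    nonadjacent-<-bound i+2≤j j<2h = ≤-trans (n≤1+n _) (≤-trans i+2≤j (<⇒≤ j<2h))

    nonadjacent-far : ∀ {i j e} → suc (suc i) ≤ j → j < double h → j ≤ e → e ≤ double h →
                      Incomparable P (point i) (point e)
    nonadjacent-far i+2≤j j<2h j≤e e≤2h =
      point-far-incomparable (<⇒≤ (nonadjacent-<-bound i+2≤j j<2h)) e≤2h (≤-trans i+2≤j j≤e)

  chains-nonadjacent-disjoint : ∀ {i j p} → suc (suc i) ≤ j → j < double h → chain i p → chain j p → ⊥
  chains-nonadjacent-disjoint {i} {j} i+2≤j j<2h pi pj with even-or-odd i
  ... | inj₁ (t , refl) =
    let p⊑i = proj₂ (chain-even-bounds (double-cancel-< t h (nonadjacent-<-bound i+2≤j j<2h)) pi) in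
    [ (λ j⊑p   → proj₂ (nonadjacent-far i+2≤j j<2h ≤-refl (<⇒≤ j<2h)) (⊑-trans j⊑p p⊑i))
    , (λ j+1⊑p → proj₂ (nonadjacent-far i+2≤j j<2h (n≤1+n j) j<2h) (⊑-trans j+1⊑p p⊑i))
    ]′ (interval-lower-end (chain⊆interval j pj))
  ... | inj₂ (t , refl) =
    let i⊑p = proj₁ (chain-odd-bounds (double-cancel-≤ (suc t) h (nonadjacent-<-bound i+2≤j j<2h)) pi) in
    [ (λ p⊑j   → proj₁ (nonadjacent-far i+2≤j j<2h ≤-refl (<⇒≤ j<2h)) (⊑-trans i⊑p p⊑j))
    , (λ p⊑j+1 → proj₁ (nonadjacent-far i+2≤j j<2h (n≤1+n j) j<2h) (⊑-trans i⊑p p⊑j+1))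
    ]′ (interval-upper-end (chain⊆interval j pj))

  chains-disjoint : ∀ i j → i < j → j < double h → ∀ p → chain i p → chain j p →
                    (j ≡ suc i) × (∀ q → chain i q → chain j q → q ≡ point (suc i))
  chains-disjoint i j i<j j<2h p pi pj with m≤n⇒m<n∨m≡n i<j
  ... | inj₁ i+2≤j = ⊥-elim (chains-nonadjacent-disjoint i+2≤j j<2h pi pj)
  ... | inj₂ refl  = refl , chains-adjacent i j<2h

  zigzagPath : 1 ≤ h → ∀ {x y} →
    f 0 ≡ OrderEmbedding.map ι x → f (double h) ≡ OrderEmbedding.map ι y →
               PathData C x y
  zigzagPath 1≤h f0≡x f2h≡y = record
    { k        = double h
    ; k≥1      = ≤-trans (n≤1+n 1) (double-mono-≤ 1≤h)
    ; c        = point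
    ; start    = f0≡x
    ; end      = trans (point-even h) (trans peak-last f2h≡y)
    ; adjComp  = point-adjacent-comparable
    ; incomp   = point-nonadjacent-incomparable
    ; alt      = point-alternates
    ; σ        = chain
    ; chains   = λ i _ → chain-isMaximal i
    ; disjoint = chains-disjoint
    }

  zigzagPath-oddPointsAreValleys : (1≤h : 1 ≤ h) → ∀ {x y} (f0≡x : f 0 ≡ OrderEmbedding.map ι x)
    (f2h≡y : f (double h) ≡ OrderEmbedding.map ι y) →
    PathValleys.OddPointsAreValleys C (zigzagPath 1≤h f0≡x f2h≡y) h
  zigzagPath-oddPointsAreValleys _ _ _ =
    refl , λ _ t<h → point-odd⊑point-prev t<h , point-odd⊑point-next t<h

module _ {M P : PO} (e : OrderEmbedding M P) where
  open OrderEmbedding e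

  IsZigzag-map : ∀ {h z} → IsZigzag M h z → IsZigzag P h (map ∘ z)
  IsZigzag-map zz a b a≤2h b≤2h =
    preserves _ _ ∘ proj₁ (zz a b a≤2h b≤2h) , proj₂ (zz a b a≤2h b≤2h) ∘ reflects _ _

IsZigzag-shorten : ∀ P {h h' z} → h' ≤ h → IsZigzag P h z → IsZigzag P h' z
IsZigzag-shorten _ h'≤h zz a b a≤2h' b≤2h' =
  zz a b (≤-trans a≤2h' (double-mono-≤ h'≤h)) (≤-trans b≤2h' (double-mono-≤ h'≤h))

IsZigzag-endpoints-distinct : ∀ P {h z} → 1 ≤ h → IsZigzag P h z → z 0 ≢ z (double h)
IsZigzag-endpoints-distinct P {h} 1≤h zz z0≡z2h =
  proj₁ (altLe-far (double-mono-≤ 1≤h))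
    (proj₂ (zz 0 (double h) z≤n ≤-refl) (IsPartialOrder.reflexive (PO.isPO P) z0≡z2h))

altEmbeds⇒zigzag : ∀ {M} h → AltEmbeds (suc (double h)) M → Σ (ℕ → PO.Carrier M) (IsZigzag M h)
altEmbeds⇒zigzag {M} h (f , _ , f-alt) = f ∘ index , λ a b a≤2h b≤2h →
  let a≡ = toℕ-index (s≤s a≤2h) ; b≡ = toℕ-index (s≤s b≤2h) in
  (λ alt → proj₁ (f-alt (index a) (index b)) (subst₂ AltLe (sym a≡) (sym b≡) alt)) ,
  (λ fa≤fb → subst₂ AltLe a≡ b≡ (proj₂ (f-alt (index a) (index b)) fa≤fb))
  where
  index : ℕ → Fin (suc (double h))
  index = extend (_<? suc (double h)) (λ _ s<n → fromℕ< s<n) (λ _ → fzero)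
  toℕ-index : ∀ {s} → s < suc (double h) → toℕ (index s) ≡ s
  toℕ-index = extend-yes (_<? suc (double h)) (λ s i → toℕ i ≡ s) (λ _ s<n → toℕ-fromℕ< s<n)

module _ {M : PO} where
  open PO M renaming (_≤_ to _⊑_)
  open Automorphism

  inverse : Automorphism M → Automorphism M
  inverse g = record
    { to      = from g
    ; from    = to g
    ; to-from = from-to g
    ; from-to = to-from g
    ; to-mono = λ x y x≤y → to-refl g _ _ (subst₂ _⊑_ (sym (to-from g x)) (sym (to-from g y)) x≤y)
    ; to-refl = λ x y p → subst₂ _⊑_ (to-from g x) (to-from g y) (to-mono g _ _ p)
    }

  _∘ᴬ_ : Automorphism M → Automorphism M → Automorphism M
  g ∘ᴬ g' = record
    { to      = to g ∘ to g'
    ; from    = from g' ∘ from g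
    ; to-from = λ x → trans (cong (to g) (to-from g' (from g x))) (to-from g x)
    ; from-to = λ x → trans (cong (from g') (from-to g (to g' x))) (from-to g' x)
    ; to-mono = λ x y → to-mono g _ _ ∘ to-mono g' _ _
    ; to-refl = λ x y → to-refl g' _ _ ∘ to-refl g _ _
    }

  automorphism⇒embedding : Automorphism M → OrderEmbedding M M
  automorphism⇒embedding g = record
    { map       = to g
    ; injective = λ x y gx≡gy → trans (sym (from-to g x)) (trans (cong (from g) gx≡gy) (from-to g y))
    ; preserves = to-mono g
    ; reflects  = to-refl g
    }

  OrbitsCollide : ℕ → ℕ → Set
  OrbitsCollide n r = ∀ (tuple : Fin (suc r) → Fin n → Carrier) →
    Σ (Fin (suc r)) λ i → Σ (Fin (suc r)) λ j → toℕ i < toℕ j ×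
    Σ (Automorphism M) λ g → ∀ x → to g (tuple i x) ≡ tuple j x

  aleph0Categorical⇒orbitsCollide : Aleph0Categorical M → ∀ n → Σ ℕ (OrbitsCollide n)
  aleph0Categorical⇒orbitsCollide ℵ₀ n with ℵ₀ n
  ... | r , reps , orbit = r , collide
    where
    collide : OrbitsCollide n r
    collide tuple with pigeonhole (n<1+n r) (proj₁ ∘ orbit ∘ tuple)
    ... | i , j , i<j , same with orbit (tuple i) | orbit (tuple j)
    ...   | oi , gi , gi-maps | oj , gj , gj-maps = i , j , i<j , gj ∘ᴬ inverse gi , λ x → begin
      to gj (from gi (tuple i x))         ≡⟨ cong (to gj ∘ from gi) (gi-maps x) ⟨
      to gj (from gi (to gi (reps oi x))) ≡⟨ cong (to gj) (from-to gi _) ⟩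
      to gj (reps oi x)                   ≡⟨ cong (λ o → to gj (reps o x)) same ⟩
      to gj (reps oj x)                   ≡⟨ gj-maps x ⟩
      tuple j x                           ∎
      where open ≡-Reasoning

module _ {M : PO} (count : Countable M) (C : PathCompletion M) (cycleFree : CycleFree C) where
  open PathCompletion C
  open PathCompletionCountable C (proj₁ count) (proj₂ count) using (code⁺; code⁺-injective)

  -- Two zigzags with the same endpoints both yield paths between them in M⁺; these coincide,
  -- and the valleys count the half-length.
  zigzag-length-≤ : ∀ {h₁ h₂ z₁ z₂} → 1 ≤ h₁ → 1 ≤ h₂ → IsZigzag M h₁ z₁ → IsZigzag M h₂ z₂ →
    z₁ 0 ≡ z₂ 0 → z₁ (double h₁) ≡ z₂ (double h₂) → h₁ ≤ h₂
  zigzag-length-≤ {h₁} {h₂} {z₁} {z₂} 1≤h₁ 1≤h₂ zz₁ zz₂ same-start same-end =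
    PathValleys.valley-count-≤ C π₁ π₂
      (Z₁.zigzagPath-oddPointsAreValleys 1≤h₁ refl refl)
      (Z₂.zigzagPath-oddPointsAreValleys 1≤h₂ start₂ end₂)
      (cycleFree _ _ π₁ π₂)
    where
    ι̂ : PO.Carrier M → PO.Carrier P
    ι̂ = OrderEmbedding.map ι
    module Z₁ = ZigzagPath C code⁺ code⁺-injective h₁ (ι̂ ∘ z₁) (IsZigzag-map ι zz₁)
    module Z₂ = ZigzagPath C code⁺ code⁺-injective h₂ (ι̂ ∘ z₂) (IsZigzag-map ι zz₂)
    start₂ : ι̂ (z₂ 0) ≡ ι̂ (z₁ 0)
    start₂ = cong ι̂ (sym same-start)
    end₂ : ι̂ (z₂ (double h₂)) ≡ ι̂ (z₁ (double h₁))
    end₂ = cong ι̂ (sym same-end)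
    π₁ π₂ : PathData C (z₁ 0) (z₁ (double h₁))
    π₁ = Z₁.zigzagPath 1≤h₁ refl refl
    π₂ = Z₂.zigzagPath 1≤h₂ start₂ end₂

  zigzag-length-unique : ∀ {h₁ h₂ z₁ z₂} → IsZigzag M h₁ z₁ → IsZigzag M h₂ z₂ →
    z₁ 0 ≡ z₂ 0 → z₁ (double h₁) ≡ z₂ (double h₂) → h₁ ≡ h₂
  zigzag-length-unique {zero}  {zero}  _   _   _          _        = refl
  zigzag-length-unique {zero}  {suc _} _   zz₂ same-start same-end =
    ⊥-elim (IsZigzag-endpoints-distinct M (s≤s z≤n) zz₂ (trans (sym same-start) same-end))
  zigzag-length-unique {suc _} {zero}  zz₁ _   same-start same-end =
    ⊥-elim (IsZigzag-endpoints-distinct M (s≤s z≤n) zz₁ (trans same-start (sym same-end)))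
  zigzag-length-unique {suc _} {suc _} zz₁ zz₂ same-start same-end = ≤-antisym
    (zigzag-length-≤ (s≤s z≤n) (s≤s z≤n) zz₁ zz₂ same-start same-end)
    (zigzag-length-≤ (s≤s z≤n) (s≤s z≤n) zz₂ zz₁ (sym same-start) (sym same-end))

proposition4p7 : (M : PO) → Countable M → (C : PathCompletion M) → CycleFree C →
    (∀ (n : ℕ) → AltEmbeds n M) → ¬ Aleph0Categorical M
proposition4p7 M count C cycleFree alt ℵ₀
  with aleph0Categorical⇒orbitsCollide ℵ₀ 2
... | r , collide with altEmbeds⇒zigzag {M} r (alt (suc (double r)))
... | z , zz with collide (λ i → z 0 ∷ z (double (toℕ i)) ∷ [])
... | i , j , i<j , g , g-maps = <-irrefl (sym same-length) i<j
  where
  zz-j : IsZigzag M (toℕ j) z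
  zz-j = IsZigzag-shorten M (toℕ≤pred[n] j) zz
  gz-i : IsZigzag M (toℕ i) (Automorphism.to g ∘ z)
  gz-i = IsZigzag-map (automorphism⇒embedding g) (IsZigzag-shorten M (toℕ≤pred[n] i) zz)
  same-length : toℕ j ≡ toℕ i
  same-length = zigzag-length-unique count C cycleFree zz-j gz-i
    (sym (g-maps fzero)) (sym (g-maps (fsuc fzero)))
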